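{- For $s_1,s_2,s_3\in\mathbb{Z}_{>0}$, the base polytope $B(M(\mathcal{D}_{s_1,s_2,s_3}))$ is unimodularly equivalent to the edge polytope $P_{K_{s_1,s_2,s_3}}$ of the complete tripartite graph $K_{s_1,s_2,s_3}$.
   Context: $\mathcal{D}_{s_1,s_2,s_3}$ is the multigraph on vertices $v_1,v_2,v_3$ with $s_1$ parallel edges between $v_1,v_2$, $s_2$ between $v_2,v_3$, and $s_3$ between $v_3,v_1$. $M(G)$ is the graphic matroid (bases = spanning forests) and $B(M)=\mathrm{conv}\{\chi_B: B\text{ basis}\}$. For a graph $G$, $P_G=\mathrm{conv}\{\chi_e: e\in E(G)\}\subset\mathbb{R}^{V(G)}$, where $\chi_e$ is the indicator vector of the two endpoints of $e$. $K_{s_1,s_2,s_3}$ has vertex set $V_1\sqcup V_2\sqcup V_3$ with $|V_i|=s_i$ and edges joining every pair of vertices in different parts.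
   Formalization: The polytopes $B(M(\mathcal{D}_{s_1,s_2,s_3}))$ and $P_{K_{s_1,s_2,s_3}}$ consist of their rational points, rational convex combinations of their vertices, rather than real points, and the unimodular equivalence is checked on rational points. -}

module Defs where

open import Data.Nat as ℕ using (ℕ; zero; suc)
open import Data.Fin using (Fin; zero; suc; splitAt)
open import Data.Fin.Subset using (Subset; _∈_; _∉_; ⁅_⁆; _∪_; inside; outside)
open import Data.Sum using (_⊎_; inj₁; inj₂)
open import Data.Product using (_×_; _,_; Σ; ∃; ∃-syntax)
open import Data.List using (List; []; _∷_)
open import Data.List.Relation.Unary.All using (All)
open import Data.List.Relation.Unary.Unique.Propositional using (Unique)
open import Data.Vec using (lookup)
open import Data.Integer as ℤ using (ℤ)
open import Data.Rational as ℚ using (ℚ; 0ℚ; 1ℚ)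
open import Relation.Binary.PropositionalEquality using (_≡_; _≢_)
open import Relation.Nullary using (¬_)

Σℚ : {n : ℕ} → (Fin n → ℚ) → ℚ
Σℚ {zero}  f = 0ℚ
Σℚ {suc n} f = f zero ℚ.+ Σℚ (λ i → f (suc i))

Σℤ : {n : ℕ} → (Fin n → ℤ) → ℤ
Σℤ {zero}  f = ℤ.0ℤ
Σℤ {suc n} f = f zero ℤ.+ Σℤ (λ i → f (suc i))

Point : ℕ → Set
Point n = Fin n → ℚ

PointSet : ℕ → Set₁
PointSet n = Point n → Set

weightSum : {n : ℕ} → List (ℚ × Point n) → ℚ
weightSum []             = 0ℚ
weightSum ((w , p) ∷ ps) = w ℚ.+ weightSum ps

combo : {n : ℕ} → List (ℚ × Point n) → Fin n → ℚ
combo []             i = 0ℚ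
combo ((w , p) ∷ ps) i = w ℚ.* p i ℚ.+ combo ps i

Conv : {n : ℕ} → PointSet n → PointSet n
Conv {n} S x =
  Σ (List (ℚ × Point n)) λ ps →
    All (λ wp → (0ℚ ℚ.≤ Data.Product.proj₁ wp) × S (Data.Product.proj₂ wp)) ps
    × weightSum ps ≡ 1ℚ
    × (∀ i → x i ≡ combo ps i)

Matrix : ℕ → Set
Matrix n = Fin n → Fin n → ℤ

_·_ : {n : ℕ} → Matrix n → Matrix n → Matrix n
(A · B) i j = Σℤ (λ k → A i k ℤ.* B k j)

idMat : {n : ℕ} → Matrix n
idMat zero    zero    = ℤ.1ℤ
idMat zero    (suc j) = ℤ.0ℤ
idMat (suc i) zero    = ℤ.0ℤ
idMat (suc i) (suc j) = idMat i j

toℚ : ℤ → ℚ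
toℚ z = z ℚ./ 1

affine : {n : ℕ} → Matrix n → (Fin n → ℤ) → Point n → Point n
affine U b x i = Σℚ (λ j → toℚ (U i j) ℚ.* x j) ℚ.+ toℚ (b i)

UnimodularlyEquivalent : {n : ℕ} → PointSet n → PointSet n → Set
UnimodularlyEquivalent {n} P Q =
  Σ (Matrix n) λ U → Σ (Matrix n) λ V → Σ (Fin n → ℤ) λ b →
    (∀ i j → (U · V) i j ≡ idMat i j)
    × (∀ i j → (V · U) i j ≡ idMat i j)
    × (∀ x → (P x → Q (affine U b x)) × (Q (affine U b x) → P x))

record Multigraph (k m : ℕ) : Set where
  field ends : Fin m → Fin k × Fin k
open Multigraph public

Joins : {k m : ℕ} → Multigraph k m → Fin m → Fin k → Fin k → Set
Joins G e u w = (ends G e ≡ (u , w)) ⊎ (ends G e ≡ (w , u))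

data Walk {k m : ℕ} (G : Multigraph k m) : Fin k → List (Fin m) → Fin k → Set where
  nil  : ∀ {u} → Walk G u [] u
  cons : ∀ {u w v e es} → Joins G e u w → Walk G w es v → Walk G u (e ∷ es) v

-- an edge set contains a cycle iff it contains a closed trail
-- (nonempty closed walk with pairwise distinct edges)
HasCycle : {k m : ℕ} → Multigraph k m → Subset m → Set
HasCycle G F =
  ∃[ u ] ∃[ es ] (es ≢ []) × All (_∈ F) es × Unique es × Walk G u es u

Forest : {k m : ℕ} → Multigraph k m → Subset m → Set
Forest G F = ¬ HasCycle G F

-- bases of the graphic matroid M(G): maximal forests (spanning forests)
IsBasis : {k m : ℕ} → Multigraph k m → Subset m → Set
IsBasis {m = m} G F = Forest G F × (∀ (e : Fin m) → e ∉ F → ¬ Forest G (⁅ e ⁆ ∪ F))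

χ : {m : ℕ} → Subset m → Point m
χ F i with lookup F i
... | inside  = 1ℚ
... | outside = 0ℚ

BasePolytope : {k m : ℕ} → Multigraph k m → PointSet m
BasePolytope G = Conv (λ p → ∃[ B ] IsBasis G B × (∀ i → p i ≡ χ B i))

unitVec : {n : ℕ} → Fin n → Point n
unitVec zero    zero    = 1ℚ
unitVec zero    (suc j) = 0ℚ
unitVec (suc i) zero    = 0ℚ
unitVec (suc i) (suc j) = unitVec i j

EdgePolytope : {n : ℕ} → (Fin n → Fin n → Set) → PointSet n
EdgePolytope Adj =
  Conv (λ p → ∃[ u ] ∃[ v ] Adj u v × (∀ i → p i ≡ unitVec u i ℚ.+ unitVec v i))

v₁ v₂ v₃ : Fin 3
v₁ = zero
v₂ = suc zero
v₃ = suc (suc zero)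

block : (s₁ s₂ s₃ : ℕ) → Fin (s₁ ℕ.+ (s₂ ℕ.+ s₃)) → Fin 3
block s₁ s₂ s₃ x with splitAt s₁ x
... | inj₁ _ = v₁
... | inj₂ y with splitAt s₂ y
...   | inj₁ _ = v₂
...   | inj₂ _ = v₃

𝒟 : (s₁ s₂ s₃ : ℕ) → Multigraph 3 (s₁ ℕ.+ (s₂ ℕ.+ s₃))
ends (𝒟 s₁ s₂ s₃) e with splitAt s₁ e
... | inj₁ _ = v₁ , v₂
... | inj₂ y with splitAt s₂ y
...   | inj₁ _ = v₂ , v₃
...   | inj₂ _ = v₃ , v₁

K : (s₁ s₂ s₃ : ℕ) → Fin (s₁ ℕ.+ (s₂ ℕ.+ s₃)) → Fin (s₁ ℕ.+ (s₂ ℕ.+ s₃)) → Set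
K s₁ s₂ s₃ u v = block s₁ s₂ s₃ u ≢ block s₁ s₂ s₃ v

{-# OPTIONS --safe #-}
module Submission where

-- A basis of 𝒟 consists of exactly two edges from different parallel classes:
-- two parallel edges form a 2-cycle and three edges from pairwise different
-- classes form a triangle, while a non-parallel pair is a forest to which any
-- further edge adds a cycle (s₁, s₂, s₃ ≥ 1 provides an edge outside the class
-- of a lone edge, so no basis has fewer than two edges). Identifying the edges of
-- 𝒟 with the vertices of K and the parallel classes with its parts, the
-- indicator vectors χ_B of the bases are exactly the edge vectors e_a + e_b of
-- K, so the two polytopes coincide and the identity is the required map.

open import Defs
open import Data.Nat using (ℕ; _≤_; s≤s; z≤n)
import Data.Nat as ℕ
open import Data.Fin using (Fin; zero; suc; splitAt; _↑ʳ_)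
open import Data.Fin.Properties using (_≟_; any?; splitAt-↑ʳ)
open import Data.Fin.Subset using (Subset; _∈_; _∉_; _⊆_; ⁅_⁆; _∪_; inside; outside)
open import Data.Fin.Subset.Properties using (_∈?_; x∈⁅x⁆; x∈⁅y⁆⇒x≡y; x∈p∪q⁻; x∈p∪q⁺)
open import Data.Sum as Sum using (_⊎_; inj₁; inj₂)
open import Data.Product using (_×_; _,_; ∃-syntax; proj₁; proj₂; map₂)
open import Data.Product.Properties using (×-≡,≡←≡)
open import Data.List using ([]; _∷_)
open import Data.List.Relation.Unary.All as All using ([]; _∷_)
open import Data.List.Relation.Unary.AllPairs using ([]; _∷_)
open import Data.Vec using (lookup)
open import Data.Vec.Properties using ([]=⇒lookup; lookup⇒[]=)
open import Data.Integer as ℤ using (ℤ)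
import Data.Integer.Properties as ℤₚ
open import Data.Rational as ℚ using (ℚ; 0ℚ; 1ℚ)
import Data.Rational.Properties as ℚₚ
open import Data.Empty using (⊥-elim)
open import Function using (_∘_; id)
open import Relation.Binary.PropositionalEquality
open import Relation.Nullary using (¬_; yes; no)
open import Relation.Nullary.Decidable using (_×-dec_; ¬?)

Σℤ-zero : ∀ n → Σℤ {n} (λ _ → ℤ.0ℤ) ≡ ℤ.0ℤ
Σℤ-zero ℕ.zero    = refl
Σℤ-zero (ℕ.suc n) = trans (ℤₚ.+-identityˡ _) (Σℤ-zero n)

Σℤ-idMat : ∀ {n} (i : Fin n) (f : Fin n → ℤ) → Σℤ (λ k → idMat i k ℤ.* f k) ≡ f i
Σℤ-idMat {ℕ.suc n} zero f =
  trans (cong₂ ℤ._+_ (ℤₚ.*-identityˡ (f zero)) (Σℤ-zero n)) (ℤₚ.+-identityʳ (f zero))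
Σℤ-idMat (suc i) f = trans (ℤₚ.+-identityˡ _) (Σℤ-idMat i (f ∘ suc))

idMat-·-idMat : ∀ {n} (i j : Fin n) → (idMat · idMat) i j ≡ idMat i j
idMat-·-idMat i j = Σℤ-idMat i (λ k → idMat k j)

Σℚ-zero : ∀ {n} (g : Fin n → ℚ) → Σℚ (λ k → toℚ ℤ.0ℤ ℚ.* g k) ≡ 0ℚ
Σℚ-zero {ℕ.zero}  g = refl
Σℚ-zero {ℕ.suc n} g = cong₂ ℚ._+_ (ℚₚ.*-zeroˡ (g zero)) (Σℚ-zero (g ∘ suc))

Σℚ-idMat : ∀ {n} (i : Fin n) (f : Fin n → ℚ) → Σℚ (λ k → toℚ (idMat i k) ℚ.* f k) ≡ f i
Σℚ-idMat zero f =
  trans (cong₂ ℚ._+_ (ℚₚ.*-identityˡ (f zero)) (Σℚ-zero (f ∘ suc))) (ℚₚ.+-identityʳ (f zero))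
Σℚ-idMat (suc i) f =
  trans (cong₂ ℚ._+_ (ℚₚ.*-zeroˡ (f zero)) (Σℚ-idMat i (f ∘ suc))) (ℚₚ.+-identityˡ (f (suc i)))

affine-identity : ∀ {n} (x : Point n) i → affine idMat (λ _ → ℤ.0ℤ) x i ≡ x i
affine-identity x i = trans (ℚₚ.+-identityʳ _) (Σℚ-idMat i x)

Conv-mono : ∀ {n} {S T : PointSet n} → (∀ p → S p → T p) → ∀ {x} → Conv S x → Conv T x
Conv-mono S⊆T (ps , ps∈S , total , x≡) = ps , All.map (map₂ (S⊆T _)) ps∈S , total , x≡

Conv-resp : ∀ {n} {S : PointSet n} {x y : Point n} → (∀ i → x i ≡ y i) → Conv S x → Conv S y
Conv-resp x≗y (ps , ps∈S , total , x≡) = ps , ps∈S , total , λ i → trans (sym (x≗y i)) (x≡ i)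

Conv-unimodularlyEquivalent : ∀ {n} {S T : PointSet n} →
  (∀ p → S p → T p) → (∀ p → T p → S p) → UnimodularlyEquivalent (Conv S) (Conv T)
Conv-unimodularlyEquivalent S⊆T T⊆S =
  idMat , idMat , (λ _ → ℤ.0ℤ) , idMat-·-idMat , idMat-·-idMat ,
  λ x → Conv-resp (sym ∘ affine-identity x) ∘ Conv-mono S⊆T
      , Conv-mono T⊆S ∘ Conv-resp (affine-identity x)

unitVec-diag : ∀ {n} (a : Fin n) → unitVec a a ≡ 1ℚ
unitVec-diag zero    = refl
unitVec-diag (suc a) = unitVec-diag a

unitVec-offdiag : ∀ {n} {a i : Fin n} → a ≢ i → unitVec a i ≡ 0ℚ
unitVec-offdiag {a = zero}  {zero}  a≢i = ⊥-elim (a≢i refl)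
unitVec-offdiag {a = zero}  {suc i} _   = refl
unitVec-offdiag {a = suc a} {zero}  _   = refl
unitVec-offdiag {a = suc a} {suc i} a≢i = unitVec-offdiag (a≢i ∘ cong suc)

χ-inside : ∀ {m} {F : Subset m} {i} → i ∈ F → χ F i ≡ 1ℚ
χ-inside i∈F rewrite []=⇒lookup i∈F = refl

χ-outside : ∀ {m} {F : Subset m} {i} → i ∉ F → χ F i ≡ 0ℚ
χ-outside {F = F} {i} i∉F with lookup F i in eq
... | inside  = ⊥-elim (i∉F (lookup⇒[]= i F eq))
... | outside = refl

∈-pair⁻ : ∀ {m} {a b x : Fin m} → x ∈ ⁅ a ⁆ ∪ ⁅ b ⁆ → x ≡ a ⊎ x ≡ b
∈-pair⁻ {a = a} {b} = Sum.map (x∈⁅y⁆⇒x≡y a) (x∈⁅y⁆⇒x≡y b) ∘ x∈p∪q⁻ ⁅ a ⁆ ⁅ b ⁆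

∈-pair⁺ : ∀ {m} {a b x : Fin m} → x ≡ a ⊎ x ≡ b → x ∈ ⁅ a ⁆ ∪ ⁅ b ⁆
∈-pair⁺ (inj₁ refl) = x∈p∪q⁺ (inj₁ (x∈⁅x⁆ _))
∈-pair⁺ (inj₂ refl) = x∈p∪q⁺ (inj₂ (x∈⁅x⁆ _))

⊆-pair-or-third : ∀ {m} (F : Subset m) (a b : Fin m) →
  F ⊆ ⁅ a ⁆ ∪ ⁅ b ⁆ ⊎ ∃[ c ] c ∈ F × c ≢ a × c ≢ b
⊆-pair-or-third F a b with any? (λ c → c ∈? F ×-dec ¬? (c ≟ a) ×-dec ¬? (c ≟ b))
... | yes third   = inj₂ third
... | no no-third = inj₁ λ {x} x∈F → ∈-pair⁺ (a-or-b x∈F)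
  where
  a-or-b : ∀ {x} → x ∈ F → x ≡ a ⊎ x ≡ b
  a-or-b {x} x∈F with x ≟ a | x ≟ b
  ... | yes x≡a | _       = inj₁ x≡a
  ... | no _    | yes x≡b = inj₂ x≡b
  ... | no x≢a  | no x≢b  = ⊥-elim (no-third (x , x∈F , x≢a , x≢b))

χ-pair : ∀ {m} {F : Subset m} {a b : Fin m} → a ≢ b → a ∈ F → b ∈ F → F ⊆ ⁅ a ⁆ ∪ ⁅ b ⁆ →
  ∀ i → χ F i ≡ unitVec a i ℚ.+ unitVec b i
χ-pair {a = a} {b} a≢b a∈F b∈F F⊆ab i with i ≟ a | i ≟ b
... | yes refl | yes refl = ⊥-elim (a≢b refl)
... | yes refl | no a≢b′ =
  trans (χ-inside a∈F) (sym (cong₂ ℚ._+_ (unitVec-diag a) (unitVec-offdiag (≢-sym a≢b′))))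
... | no b≢a   | yes refl =
  trans (χ-inside b∈F) (sym (cong₂ ℚ._+_ (unitVec-offdiag (≢-sym b≢a)) (unitVec-diag b)))
... | no i≢a   | no i≢b   =
  trans (χ-outside (Sum.[ i≢a , i≢b ] ∘ ∈-pair⁻ ∘ F⊆ab))
        (sym (cong₂ ℚ._+_ (unitVec-offdiag (≢-sym i≢a)) (unitVec-offdiag (≢-sym i≢b))))

module _ {k m : ℕ} {G : Multigraph k m} where

  Joins-sym : ∀ {e u w} → Joins G e u w → Joins G e w u
  Joins-sym = Sum.swap

  parallel⇒cycle : ∀ {F a b u w} → a ≢ b → a ∈ F → b ∈ F →
    Joins G a u w → Joins G b u w → HasCycle G F
  parallel⇒cycle {u = u} a≢b a∈F b∈F ja jb =
    u , _ ∷ _ ∷ [] , (λ ()) , a∈F ∷ b∈F ∷ [] , (a≢b ∷ []) ∷ [] ∷ [] ,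
    cons ja (cons (Joins-sym jb) nil)

  triangle⇒cycle : ∀ {F a b c u w t} → a ≢ b → b ≢ c → a ≢ c → a ∈ F → b ∈ F → c ∈ F →
    Joins G a u w → Joins G b w t → Joins G c t u → HasCycle G F
  triangle⇒cycle {u = u} a≢b b≢c a≢c a∈F b∈F c∈F ja jb jc =
    u , _ ∷ _ ∷ _ ∷ [] , (λ ()) , a∈F ∷ b∈F ∷ c∈F ∷ [] ,
    (a≢b ∷ a≢c ∷ []) ∷ (b≢c ∷ []) ∷ [] ∷ [] , cons ja (cons jb (cons jc nil))

  pair⇒forest : ∀ {F a b} → (∀ e u → ¬ Joins G e u u) →
    (∀ {u w} → Joins G a u w → ¬ Joins G b u w) → F ⊆ ⁅ a ⁆ ∪ ⁅ b ⁆ → Forest G F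
  pair⇒forest {a = a} {b} loopless ¬parallel F⊆ab = no-closed-trail
    where
    in-pair : ∀ {x} → x ∈ _ → x ≡ a ⊎ x ≡ b
    in-pair = ∈-pair⁻ ∘ F⊆ab

    no-two-edge-trail : ∀ {x y u w} → x ≢ y → x ≡ a ⊎ x ≡ b → y ≡ a ⊎ y ≡ b →
      Joins G x u w → ¬ Joins G y w u
    no-two-edge-trail x≢y (inj₁ refl) (inj₁ refl) _  _  = x≢y refl
    no-two-edge-trail _   (inj₁ refl) (inj₂ refl) jx jy = ¬parallel jx (Joins-sym jy)
    no-two-edge-trail _   (inj₂ refl) (inj₁ refl) jx jy = ¬parallel jy (Joins-sym jx)
    no-two-edge-trail x≢y (inj₂ refl) (inj₂ refl) _  _  = x≢y refl

    no-three-distinct : ∀ {x y z} → x ≢ y → x ≢ z → y ≢ z →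
      x ≡ a ⊎ x ≡ b → y ≡ a ⊎ y ≡ b → ¬ (z ≡ a ⊎ z ≡ b)
    no-three-distinct x≢y _   _   (inj₁ refl) (inj₁ refl) _           = x≢y refl
    no-three-distinct x≢y _   _   (inj₂ refl) (inj₂ refl) _           = x≢y refl
    no-three-distinct _   x≢z _   (inj₁ refl) _           (inj₁ refl) = x≢z refl
    no-three-distinct _   x≢z _   (inj₂ refl) _           (inj₂ refl) = x≢z refl
    no-three-distinct _   _   y≢z (inj₁ refl) (inj₂ refl) (inj₂ refl) = y≢z refl
    no-three-distinct _   _   y≢z (inj₂ refl) (inj₁ refl) (inj₁ refl) = y≢z refl

    no-closed-trail : ¬ HasCycle G _
    no-closed-trail (_ , [] , nonempty , _) = nonempty refl
    no-closed-trail (u , x ∷ [] , _ , _ , _ , cons j nil) = loopless x u j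
    no-closed-trail (_ , _ ∷ _ ∷ [] , _ , x∈F ∷ y∈F ∷ [] , (x≢y ∷ []) ∷ _ , cons jx (cons jy nil)) =
      no-two-edge-trail x≢y (in-pair x∈F) (in-pair y∈F) jx jy
    no-closed-trail (_ , _ ∷ _ ∷ _ ∷ _ , _ , x∈F ∷ y∈F ∷ z∈F ∷ _ ,
                     (x≢y ∷ x≢z ∷ _) ∷ (y≢z ∷ _) ∷ _ , _) =
      no-three-distinct x≢y x≢z y≢z (in-pair x∈F) (in-pair y∈F) (in-pair z∈F)

next : Fin 3 → Fin 3
next zero             = suc zero
next (suc zero)       = suc (suc zero)
next (suc (suc zero)) = zero

next-≢ : ∀ x → next x ≢ x
next-≢ zero             ()
next-≢ (suc zero)       ()
next-≢ (suc (suc zero)) ()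

next²-≢ : ∀ x → next (next x) ≢ x
next²-≢ zero             ()
next²-≢ (suc zero)       ()
next²-≢ (suc (suc zero)) ()

next-asymmetric : ∀ {x y} → next x ≡ y → next y ≢ x
next-asymmetric refl = next²-≢ _

next³ : ∀ x → next (next (next x)) ≡ x
next³ zero             = refl
next³ (suc zero)       = refl
next³ (suc (suc zero)) = refl

next-injective : ∀ {x y} → next x ≡ next y → x ≡ y
next-injective {x} {y} eq = trans (sym (next³ x)) (trans (cong (next ∘ next) eq) (next³ y))

≢⇒next : ∀ {x y} → x ≢ y → next x ≡ y ⊎ next y ≡ x
≢⇒next {zero}             {zero}             x≢y = ⊥-elim (x≢y refl)
≢⇒next {zero}             {suc zero}         _   = inj₁ refl
≢⇒next {zero}             {suc (suc zero)}   _   = inj₂ refl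
≢⇒next {suc zero}         {zero}             _   = inj₂ refl
≢⇒next {suc zero}         {suc zero}         x≢y = ⊥-elim (x≢y refl)
≢⇒next {suc zero}         {suc (suc zero)}   _   = inj₁ refl
≢⇒next {suc (suc zero)}   {zero}             _   = inj₁ refl
≢⇒next {suc (suc zero)}   {suc zero}         _   = inj₂ refl
≢⇒next {suc (suc zero)}   {suc (suc zero)}   x≢y = ⊥-elim (x≢y refl)

cyclic-order : ∀ {x y z} → x ≢ y → y ≢ z → x ≢ z →
  (next x ≡ y × next y ≡ z × next z ≡ x) ⊎ (next y ≡ x × next z ≡ y × next x ≡ z)
cyclic-order {x} x≢y y≢z x≢z with ≢⇒next x≢y | ≢⇒next y≢z
... | inj₁ refl | inj₁ refl = inj₁ (refl , refl , next³ x)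
... | inj₁ refl | inj₂ zy   = ⊥-elim (x≢z (next-injective (sym zy)))
... | inj₂ yx   | inj₁ yz   = ⊥-elim (x≢z (trans (sym yx) yz))
... | inj₂ refl | inj₂ refl = inj₂ (refl , refl , next³ _)

-- BasePolytope G and EdgePolytope Adj are definitionally Conv of these sets.
BasisVectors : ∀ {k m} → Multigraph k m → PointSet m
BasisVectors G p = ∃[ B ] IsBasis G B × (∀ i → p i ≡ χ B i)

EdgeVectors : ∀ {n} → (Fin n → Fin n → Set) → PointSet n
EdgeVectors Adj p = ∃[ u ] ∃[ v ] Adj u v × (∀ i → p i ≡ unitVec u i ℚ.+ unitVec v i)

block-surjective : ∀ {s₁ s₂ s₃} → 1 ≤ s₁ → 1 ≤ s₂ → 1 ≤ s₃ → ∀ c → ∃[ e ] block s₁ s₂ s₃ e ≡ c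
block-surjective (s≤s z≤n) _ _ zero = zero , refl
block-surjective {s₁} {ℕ.suc t₂} {s₃} _ (s≤s z≤n) _ (suc zero) = s₁ ↑ʳ zero , in-block₂
  where
  in-block₂ : block s₁ (ℕ.suc t₂) s₃ (s₁ ↑ʳ zero) ≡ suc zero
  in-block₂ rewrite splitAt-↑ʳ s₁ (ℕ.suc t₂ ℕ.+ s₃) zero = refl
block-surjective {s₁} {s₂} {ℕ.suc t₃} _ _ (s≤s z≤n) (suc (suc zero)) =
  s₁ ↑ʳ (s₂ ↑ʳ zero) , in-block₃
  where
  in-block₃ : block s₁ s₂ (ℕ.suc t₃) (s₁ ↑ʳ (s₂ ↑ʳ zero)) ≡ suc (suc zero)
  in-block₃ rewrite splitAt-↑ʳ s₁ (s₂ ℕ.+ ℕ.suc t₃) (s₂ ↑ʳ zero)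
                  | splitAt-↑ʳ s₂ (ℕ.suc t₃) zero = refl

module 𝒟-Properties (s₁ s₂ s₃ : ℕ) where

  private
    G : Multigraph 3 (s₁ ℕ.+ (s₂ ℕ.+ s₃))
    G = 𝒟 s₁ s₂ s₃

    blk : Fin (s₁ ℕ.+ (s₂ ℕ.+ s₃)) → Fin 3
    blk = block s₁ s₂ s₃

  ends-𝒟 : ∀ e → ends G e ≡ (blk e , next (blk e))
  ends-𝒟 e with splitAt s₁ e
  ... | inj₁ _ = refl
  ... | inj₂ y with splitAt s₂ y
  ...   | inj₁ _ = refl
  ...   | inj₂ _ = refl

  𝒟-joins : ∀ {e u w} → blk e ≡ u → next u ≡ w → Joins G e u w
  𝒟-joins {e} refl refl = inj₁ (ends-𝒟 e)

  𝒟-joins⁻ : ∀ {e u w} → Joins G e u w →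
    (blk e ≡ u × next (blk e) ≡ w) ⊎ (blk e ≡ w × next (blk e) ≡ u)
  𝒟-joins⁻ {e} = Sum.map (×-≡,≡←≡ ∘ trans (sym (ends-𝒟 e))) (×-≡,≡←≡ ∘ trans (sym (ends-𝒟 e)))

  𝒟-loopless : ∀ e u → ¬ Joins G e u u
  𝒟-loopless e u = Sum.[ fixpoint , fixpoint ] ∘ 𝒟-joins⁻
    where
    fixpoint : ¬ (blk e ≡ u × next (blk e) ≡ u)
    fixpoint (e≡u , next-e≡u) = next-≢ (blk e) (trans next-e≡u (sym e≡u))

  parallel⇒same-block : ∀ {a b u w} → Joins G a u w → Joins G b u w → blk a ≡ blk b
  parallel⇒same-block ja jb with 𝒟-joins⁻ ja | 𝒟-joins⁻ jb
  ... | inj₁ (a≡u , _)    | inj₁ (b≡u , _)    = trans a≡u (sym b≡u)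
  ... | inj₂ (a≡w , _)    | inj₂ (b≡w , _)    = trans a≡w (sym b≡w)
  ... | inj₁ (a≡u , na≡w) | inj₂ (b≡w , nb≡u) =
    ⊥-elim (next-asymmetric (trans na≡w (sym b≡w)) (trans nb≡u (sym a≡u)))
  ... | inj₂ (a≡w , na≡u) | inj₁ (b≡u , nb≡w) =
    ⊥-elim (next-asymmetric (trans nb≡w (sym a≡w)) (trans na≡u (sym b≡u)))

  same-block⇒cycle : ∀ {F a b} → a ≢ b → a ∈ F → b ∈ F → blk a ≡ blk b → HasCycle G F
  same-block⇒cycle a≢b a∈F b∈F a~b =
    parallel⇒cycle a≢b a∈F b∈F (𝒟-joins refl refl) (𝒟-joins (sym a~b) refl)

  three-edges⇒cycle : ∀ {F a b c} → a ≢ b → b ≢ c → a ≢ c → a ∈ F → b ∈ F → c ∈ F → HasCycle G F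
  three-edges⇒cycle {a = a} {b} {c} a≢b b≢c a≢c a∈F b∈F c∈F
    with blk a ≟ blk b | blk b ≟ blk c | blk a ≟ blk c
  ... | yes a~b | _       | _       = same-block⇒cycle a≢b a∈F b∈F a~b
  ... | no _    | yes b~c | _       = same-block⇒cycle b≢c b∈F c∈F b~c
  ... | no _    | no _    | yes a~c = same-block⇒cycle a≢c a∈F c∈F a~c
  ... | no a≁b  | no b≁c  | no a≁c  with cyclic-order a≁b b≁c a≁c
  ...   | inj₁ (ab , bc , ca) =
    triangle⇒cycle a≢b b≢c a≢c a∈F b∈F c∈F (𝒟-joins refl ab) (𝒟-joins refl bc) (𝒟-joins refl ca)
  ...   | inj₂ (ba , cb , ac) =
    triangle⇒cycle a≢b b≢c a≢c a∈F b∈F c∈F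
      (Joins-sym {G = G} (𝒟-joins refl ac)) (Joins-sym {G = G} (𝒟-joins refl ba))
      (Joins-sym {G = G} (𝒟-joins refl cb))

  different-blocks⇒forest : ∀ {F a b} → blk a ≢ blk b → F ⊆ ⁅ a ⁆ ∪ ⁅ b ⁆ → Forest G F
  different-blocks⇒forest a≁b = pair⇒forest 𝒟-loopless (λ ja jb → a≁b (parallel⇒same-block ja jb))

  different-blocks⇒basis : ∀ {a b} → blk a ≢ blk b → IsBasis G (⁅ a ⁆ ∪ ⁅ b ⁆)
  different-blocks⇒basis {a} {b} a≁b = different-blocks⇒forest a≁b id , maximal
    where
    maximal : ∀ e → e ∉ ⁅ a ⁆ ∪ ⁅ b ⁆ → ¬ Forest G (⁅ e ⁆ ∪ (⁅ a ⁆ ∪ ⁅ b ⁆))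
    maximal e e∉ab forest = forest (three-edges⇒cycle e≢a (a≁b ∘ cong blk) e≢b e∈ a∈ b∈)
      where
      e≢a : e ≢ a
      e≢a e≡a = e∉ab (∈-pair⁺ (inj₁ e≡a))
      e≢b : e ≢ b
      e≢b e≡b = e∉ab (∈-pair⁺ (inj₂ e≡b))
      e∈ : e ∈ ⁅ e ⁆ ∪ (⁅ a ⁆ ∪ ⁅ b ⁆)
      e∈ = x∈p∪q⁺ (inj₁ (x∈⁅x⁆ e))
      a∈ : a ∈ ⁅ e ⁆ ∪ (⁅ a ⁆ ∪ ⁅ b ⁆)
      a∈ = x∈p∪q⁺ (inj₂ (∈-pair⁺ (inj₁ refl)))
      b∈ : b ∈ ⁅ e ⁆ ∪ (⁅ a ⁆ ∪ ⁅ b ⁆)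
      b∈ = x∈p∪q⁺ (inj₂ (∈-pair⁺ (inj₂ refl)))

  module _ (surjective : ∀ c → ∃[ e ] blk e ≡ c) where

    basis-not-singleton : ∀ {B a} → IsBasis G B → ¬ B ⊆ ⁅ a ⁆ ∪ ⁅ a ⁆
    basis-not-singleton {B} {a} (_ , maximal) B⊆a =
      maximal e e∉B (different-blocks⇒forest a≁e eB⊆ae)
      where
      e : Fin (s₁ ℕ.+ (s₂ ℕ.+ s₃))
      e = proj₁ (surjective (next (blk a)))
      a≁e : blk a ≢ blk e
      a≁e a~e = next-≢ (blk a) (trans (sym (proj₂ (surjective _))) (sym a~e))
      only-a : ∀ {x} → x ∈ B → x ≡ a
      only-a = Sum.[ id , id ] ∘ ∈-pair⁻ ∘ B⊆a
      e∉B : e ∉ B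
      e∉B = a≁e ∘ sym ∘ cong blk ∘ only-a
      eB⊆ae : ⁅ e ⁆ ∪ B ⊆ ⁅ a ⁆ ∪ ⁅ e ⁆
      eB⊆ae x∈ = ∈-pair⁺ (Sum.swap (Sum.map (x∈⁅y⁆⇒x≡y e) only-a (x∈p∪q⁻ ⁅ e ⁆ B x∈)))

    -- Taking a = b in ⊆-pair-or-third asks whether B lies inside a singleton.
    basis⇒different-blocks : ∀ {B} → IsBasis G B →
      ∃[ a ] ∃[ b ] blk a ≢ blk b × a ∈ B × b ∈ B × B ⊆ ⁅ a ⁆ ∪ ⁅ b ⁆
    basis⇒different-blocks {B} basis@(forest , _)
      with ⊆-pair-or-third B (proj₁ (surjective zero)) (proj₁ (surjective zero))
    ... | inj₁ B⊆e = ⊥-elim (basis-not-singleton basis B⊆e)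
    ... | inj₂ (a , a∈B , _) with ⊆-pair-or-third B a a
    ...   | inj₁ B⊆a = ⊥-elim (basis-not-singleton basis B⊆a)
    ...   | inj₂ (b , b∈B , b≢a , _) with ⊆-pair-or-third B a b
    ...     | inj₂ (c , c∈B , c≢a , c≢b) =
      ⊥-elim (forest (three-edges⇒cycle (≢-sym b≢a) (≢-sym c≢b) (≢-sym c≢a) a∈B b∈B c∈B))
    ...     | inj₁ B⊆ab = a , b , forest ∘ same-block⇒cycle (≢-sym b≢a) a∈B b∈B , a∈B , b∈B , B⊆ab

    BasisVectors⊆EdgeVectors : ∀ p → BasisVectors G p → EdgeVectors (K s₁ s₂ s₃) p
    BasisVectors⊆EdgeVectors p (B , basis , p≡χB) with basis⇒different-blocks basis
    ... | a , b , a≁b , a∈B , b∈B , B⊆ab =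
      a , b , a≁b , λ i → trans (p≡χB i) (χ-pair (a≁b ∘ cong blk) a∈B b∈B B⊆ab i)

  EdgeVectors⊆BasisVectors : ∀ p → EdgeVectors (K s₁ s₂ s₃) p → BasisVectors G p
  EdgeVectors⊆BasisVectors p (a , b , a≁b , p≡) =
    ⁅ a ⁆ ∪ ⁅ b ⁆ , different-blocks⇒basis a≁b ,
    λ i → trans (p≡ i) (sym (χ-pair (a≁b ∘ cong blk) a∈ab b∈ab id i))
    where
    a∈ab : a ∈ ⁅ a ⁆ ∪ ⁅ b ⁆
    a∈ab = ∈-pair⁺ (inj₁ refl)
    b∈ab : b ∈ ⁅ a ⁆ ∪ ⁅ b ⁆
    b∈ab = ∈-pair⁺ (inj₂ refl)

lemma4p7 : (s₁ s₂ s₃ : ℕ) → 1 ≤ s₁ → 1 ≤ s₂ → 1 ≤ s₃ →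
    UnimodularlyEquivalent (BasePolytope (𝒟 s₁ s₂ s₃)) (EdgePolytope (K s₁ s₂ s₃))
lemma4p7 s₁ s₂ s₃ h₁ h₂ h₃ =
  Conv-unimodularlyEquivalent
    (BasisVectors⊆EdgeVectors (block-surjective h₁ h₂ h₃))
    EdgeVectors⊆BasisVectors
  where open 𝒟-Properties s₁ s₂ s₃
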